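{- Let $\mathcal{M}=(X,\vec{\mathcal{C}},\mathcal{V})$ be a quasi-discrete closure model and $x_1,x_2\in X$. If $x_1$ and $x_2$ are CoPa-bisimilar in $\mathcal{M}$, then for every ${\tt ICRL}$ formula $\Phi$, $\mathcal{M},x_1\models\Phi$ iff $\mathcal{M},x_2\models\Phi$.
   Context: Fix a set $\mathtt{AP}$ of atomic propositions. For a relation $R\subseteq X\times X$ let $\mathcal{C}_R(A)=A\cup\{x\in X:\exists a\in A,\ (a,x)\in R\}$. A quasi-discrete closure model is $\mathcal{M}=(X,\vec{\mathcal{C}},\mathcal{V})$ with $\vec{\mathcal{C}}=\mathcal{C}_R$ for a relation $R\subseteq X\times X$ and $\mathcal{V}:\mathtt{AP}\to\mathcal{P}(X)$; put $\overleftarrow{\mathcal{C}}=\mathcal{C}_{R^{ -1}}$ and write $\vec{\mathcal{C}}(x)$ for $\vec{\mathcal{C}}(\{x\})$. A forward path from $x$ of length $\ell\in\mathbb{N}$ is a sequence $(x_i)_{i=0}^{\ell}$ with $x_0=x$ and $x_{i+1}\in\vec{\mathcal{C}}(x_i)$ for $i<\ell$; backward paths likewise with $\overleftarrow{\mathcal{C}}$. Given $B\subseteq X\times X$, two forward (resp. backward) paths $(x'_i)_{i=0}^{\ell}$, $(x''_j)_{j=0}^{m}$ are compatible w.r.t. $B$ if for some $N>0$ there are total monotone surjections $f:\{0,\dots,\ell\}\to\{1,\dots,N\}$, $g:\{0,\dots,m\}\to\{1,\dots,N\}$ with $(x'_i,x''_j)\in B$ whenever $f(i)=g(j)$. A symmetric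 $B$ is a CoPa-bisimulation if whenever $(x_1,x_2)\in B$: (1) $x_1\in\mathcal{V}(p)$ iff $x_2\in\mathcal{V}(p)$ for all $p\in\mathtt{AP}$; (2) every forward path from $x_1$ has a compatible (w.r.t. $B$) forward path from $x_2$; (3) the same for backward paths. Points are CoPa-bisimilar if some CoPa-bisimulation contains the pair. ${\tt ICRL}$ formulas: $\Phi::=p\mid\neg\Phi\mid\bigwedge_{i\in I}\Phi_i\mid\vec{\zeta}\,\Phi_1[\Phi_2]\mid\overleftarrow{\zeta}\,\Phi_1[\Phi_2]$, with $x\models p$ iff $x\in\mathcal{V}(p)$, usual Boolean clauses, and $x\models\vec{\zeta}\,\Phi_1[\Phi_2]$ iff some forward path $(x_i)_{i=0}^{\ell}$ from $x$ has $x_\ell\models\Phi_1$ and $x_j\models\Phi_2$ for $0\le j<\ell$; $\overleftarrow{\zeta}$ likewise with backward paths. -}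

module Defs where

open import Data.Nat using (ℕ; zero; suc; _>_)
open import Data.Fin using (Fin; zero; suc; inject₁) renaming (_≤_ to _≤F_)
open import Data.Product using (Σ; ∃; _×_; _,_)
open import Data.Sum using (_⊎_)
open import Relation.Nullary using (¬_)
open import Relation.Binary.PropositionalEquality using (_≡_)
open import Function.Definitions using (Surjective)

Pred : Set → Set₁
Pred X = X → Set

C[_] : {X : Set} → (X → X → Set) → Pred X → Pred X
C[ R ] A x = A x ⊎ Σ _ (λ a → A a × R a x)

singleton : {X : Set} → X → Pred X
singleton x y = x ≡ y

converse : {X : Set} → (X → X → Set) → X → X → Set
converse R x y = R y x

record QDCM (AP : Set) : Set₁ where
  field
    X : Set
    R : X → X → Set
    V : AP → Pred X

  Cfwd : Pred X → Pred X
  Cfwd = C[ R ]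

  Cbwd : Pred X → Pred X
  Cbwd = C[ converse R ]

record Path {X : Set} (C : Pred X → Pred X) (x : X) : Set where
  field
    len : ℕ
    pt : Fin (suc len) → X
    start : pt zero ≡ x
    step : (i : Fin len) → C (singleton (pt (inject₁ i))) (pt (suc i))
open Path public

-- Total monotone surjection {0..ℓ} → {1..N}, with {1..N} rendered as Fin N.
MonoSurj : (ℓ N : ℕ) → (Fin (suc ℓ) → Fin N) → Set
MonoSurj ℓ N f = ((i j : Fin (suc ℓ)) → i ≤F j → f i ≤F f j) × Surjective _≡_ _≡_ f

Compatible : {X : Set} {C : Pred X → Pred X} {x y : X} →
             (X → X → Set) → Path C x → Path C y → Set
Compatible B p q =
  Σ ℕ λ N → N > 0 × Σ (Fin (suc (len p)) → Fin N) λ f → Σ (Fin (suc (len q)) → Fin N) λ g →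
    MonoSurj (len p) N f × MonoSurj (len q) N g ×
    ((i : Fin (suc (len p))) (j : Fin (suc (len q))) → f i ≡ g j → B (pt p i) (pt q j))

module _ {AP : Set} (M : QDCM AP) where
  open QDCM M

  Symmetric : (X → X → Set) → Set
  Symmetric B = ∀ {a b} → B a b → B b a

  record IsCoPaBisim (B : X → X → Set) : Set where
    field
      sym : Symmetric B
      atoms : ∀ {x₁ x₂} → B x₁ x₂ → (p : AP) → (V p x₁ → V p x₂) × (V p x₂ → V p x₁)
      fwd : ∀ {x₁ x₂} → B x₁ x₂ → (π : Path Cfwd x₁) → Σ (Path Cfwd x₂) λ π' → Compatible B π π'
      bwd : ∀ {x₁ x₂} → B x₁ x₂ → (π : Path Cbwd x₁) → Σ (Path Cbwd x₂) λ π' → Compatible B π π'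

  CoPaBisimilar : X → X → Set₁
  CoPaBisimilar x₁ x₂ = Σ (X → X → Set) λ B → IsCoPaBisim B × B x₁ x₂

data ICRL (AP : Set) : Set₁ where
  atom : AP → ICRL AP
  ¬ᶠ_ : ICRL AP → ICRL AP
  ⋀ : (I : Set) → (I → ICRL AP) → ICRL AP
  ζ⃗ : ICRL AP → ICRL AP → ICRL AP   -- ζ⃗ Φ₁ Φ₂ is  →ζ Φ₁[Φ₂]
  ζ⃖ : ICRL AP → ICRL AP → ICRL AP   -- ζ⃖ Φ₁ Φ₂ is  ←ζ Φ₁[Φ₂]

module _ {AP : Set} (M : QDCM AP) where
  open QDCM M

  _⊨_ : X → ICRL AP → Set
  Reach : {x : X} {C : Pred X → Pred X} → Path C x → ICRL AP → ICRL AP → Set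
  x ⊨ atom p = V p x
  x ⊨ (¬ᶠ Φ) = ¬ (x ⊨ Φ)
  x ⊨ ⋀ I Φs = (i : I) → x ⊨ Φs i
  x ⊨ ζ⃗ Φ₁ Φ₂ = Σ (Path Cfwd x) λ π → Reach π Φ₁ Φ₂
  x ⊨ ζ⃖ Φ₁ Φ₂ = Σ (Path Cbwd x) λ π → Reach π Φ₁ Φ₂
  Reach π Φ₁ Φ₂ = (pt π (Data.Fin.fromℕ (len π)) ⊨ Φ₁) × ((j : Fin (len π)) → pt π (inject₁ j) ⊨ Φ₂)

module Submission where

-- A CoPa-bisimulation B preserves every formula, by induction on the formula;
-- negation is handled by the symmetry of B. For ζ⃗ Φ₁[Φ₂], let π witness the
-- formula at x₁ and π' be a path from x₂ compatible with it via f and g. Put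
-- c = f(last of π) and cut π' at the least k with g k = c: its endpoint is
-- B-related to the endpoint of π, and every earlier point j of π' has g j ≠ c,
-- so by surjectivity of f it is B-related to a point of π other than the last,
-- where Φ₂ holds.

open import Defs
open import Data.Nat using (suc)
open import Data.Fin using (Fin; Fin′; zero; suc; inject; inject!; inject₁; lower₁; fromℕ; toℕ; _≟_)
open import Data.Fin.Properties using (toℕ-fromℕ; toℕ-injective; inject₁-lower₁; ¬∀⟶∃¬-smallest)
open import Data.Product using (∃; _×_; _,_; proj₁; proj₂)
open import Relation.Nullary using (¬?)
open import Relation.Nullary.Decidable using (decidable-stable)
open import Relation.Binary.PropositionalEquality using (_≡_; _≢_; refl; sym; trans; cong; subst)

inject!-fromℕ : ∀ {n} (k : Fin (suc n)) → inject! {i = suc k} (fromℕ (toℕ k)) ≡ k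
inject!-fromℕ zero = refl
inject!-fromℕ {suc n} (suc k) = cong suc (inject!-fromℕ k)

inject!-inject₁ : ∀ {n} (k : Fin (suc n)) (j : Fin′ k) →
  inject! {i = suc k} (inject₁ j) ≡ inject₁ (inject! {i = k} j)
inject!-inject₁ {suc n} (suc k) zero = refl
inject!-inject₁ {suc n} (suc k) (suc j) = cong suc (inject!-inject₁ k j)

inject₁-inject! : ∀ {n} {k : Fin (suc n)} (j : Fin′ k) → inject₁ (inject! {i = k} j) ≡ inject j
inject₁-inject! {suc n} {suc k} zero = refl
inject₁-inject! {suc n} {suc k} (suc j) = cong suc (inject₁-inject! j)

≢fromℕ⇒inject₁ : ∀ {n} (i : Fin (suc n)) → i ≢ fromℕ n → ∃ λ j → inject₁ j ≡ i
≢fromℕ⇒inject₁ {n} i i≢last = lower₁ i n≢i , inject₁-lower₁ i n≢i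
  where
  n≢i : n ≢ toℕ i
  n≢i n≡i = i≢last (toℕ-injective (trans (sym n≡i) (sym (toℕ-fromℕ n))))

least-preimage : ∀ {n N} (g : Fin n → Fin N) {c : Fin N} → (∃ λ j → g j ≡ c) →
  ∃ λ k → g k ≡ c × ((j : Fin′ k) → g (inject j) ≢ c)
least-preimage {n} g {c} (j₀ , gj₀≡c)
  with ¬∀⟶∃¬-smallest n (λ j → g j ≢ c) (λ j → ¬? (g j ≟ c)) (λ all → all j₀ gj₀≡c)
... | k , ¬gk≢c , before = k , decidable-stable (g k ≟ c) ¬gk≢c , before

Preserved : {X : Set} → (X → X → Set) → Pred X → Set
Preserved B P = ∀ {a b} → B a b → P a → P b

module _ {X : Set} {C : Pred X → Pred X} where

  prefix : ∀ {x} (π : Path C x) → Fin (suc (len π)) → Path C x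
  prefix π k = record
    { len = toℕ k
    ; pt = λ i → pt π (inject! {i = suc k} i)
    ; start = start π
    ; step = λ j → subst (λ i → C (singleton (pt π i)) (pt π (suc (inject! j))))
                     (sym (inject!-inject₁ k j)) (step π (inject! j))
    }

  -- Reach M π Φ₁ Φ₂ unfolds to Until π (_⊨ Φ₁) (_⊨ Φ₂).
  Until : ∀ {x} → Path C x → Pred X → Pred X → Set
  Until π P Q = P (pt π (fromℕ (len π))) × ((j : Fin (len π)) → Q (pt π (inject₁ j)))

  until-prefix : ∀ {x} {P Q : Pred X} (π : Path C x) (k : Fin (suc (len π))) →
    P (pt π k) → ((j : Fin′ k) → Q (pt π (inject j))) → Until (prefix π k) P Q
  until-prefix {P = P} {Q} π k Pk Q-before =
    subst (λ i → P (pt π i)) (sym (inject!-fromℕ k)) Pk ,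
    λ j → subst (λ i → Q (pt π i))
            (sym (trans (inject!-inject₁ k j) (inject₁-inject! j))) (Q-before j)

  until-transfer : ∀ {B : X → X → Set} {P Q : Pred X} → Preserved B P → Preserved B Q →
    ∀ {x y} (π : Path C x) (π' : Path C y) → Compatible B π π' →
    Until π P Q → ∃ λ (ρ : Path C y) → Until ρ P Q
  until-transfer {P = P} {Q} pres-P pres-Q π π' (_ , _ , f , g , (_ , f-surj) , (_ , g-surj) , related)
                 (P-end , Q-before) =
    let k , gk≡c , g-before = least-preimage g (_ , proj₂ (g-surj c) refl)
    in prefix π' k , until-prefix {P = P} {Q} π' k (pres-P (related last k (sym gk≡c)) P-end)
                                    (Q-before-k g-before)
    where
    last = fromℕ (len π)
    c = f last

    Q-before-k : ∀ {k} → ((j : Fin′ k) → g (inject j) ≢ c) → (j : Fin′ k) → Q (pt π' (inject j))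
    Q-before-k g-before j with f-surj (g (inject j))
    ... | i , fi≡gj with ≢fromℕ⇒inject₁ i (λ { refl → g-before j (sym (fi≡gj refl)) })
    ... | i' , refl = pres-Q (related (inject₁ i') (inject j) (fi≡gj refl)) (Q-before i')

module _ {AP : Set} (M : QDCM AP) {B : QDCM.X M → QDCM.X M → Set} (bisim : IsCoPaBisim M B) where
  open IsCoPaBisim bisim using (atoms; fwd; bwd) renaming (sym to B-sym)

  ⊨-preserved : (Φ : ICRL AP) → Preserved B (λ x → _⊨_ M x Φ)
  ⊨-preserved (atom p) r = proj₁ (atoms r p)
  ⊨-preserved (¬ᶠ Φ) r ¬Φa Φb = ¬Φa (⊨-preserved Φ (B-sym r) Φb)
  ⊨-preserved (⋀ I Φs) r Φsa i = ⊨-preserved (Φs i) r (Φsa i)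
  ⊨-preserved (ζ⃗ Φ₁ Φ₂) r (π , reach) =
    let π' , compat = fwd r π in
    until-transfer {P = λ x → _⊨_ M x Φ₁} {λ x → _⊨_ M x Φ₂}
                   (⊨-preserved Φ₁) (⊨-preserved Φ₂) π π' compat reach
  ⊨-preserved (ζ⃖ Φ₁ Φ₂) r (π , reach) =
    let π' , compat = bwd r π in
    until-transfer {P = λ x → _⊨_ M x Φ₁} {λ x → _⊨_ M x Φ₂}
                   (⊨-preserved Φ₁) (⊨-preserved Φ₂) π π' compat reach

lemma5p13 : {AP : Set} (M : QDCM AP) (x₁ x₂ : QDCM.X M) →
    CoPaBisimilar M x₁ x₂ →
    (Φ : ICRL AP) → (_⊨_ M x₁ Φ → _⊨_ M x₂ Φ) × (_⊨_ M x₂ Φ → _⊨_ M x₁ Φ)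
lemma5p13 M x₁ x₂ (B , bisim , r) Φ =
  ⊨-preserved M bisim Φ r , ⊨-preserved M bisim Φ (IsCoPaBisim.sym bisim r)
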